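{- Let $M$ be a matroid and let $I_m$ be the number of independent sets of size $m$ in $M$. Then $$T^2_M(2,2;1,1)=\sum_{m=0}^{\mathrm{rk}(M)}2^m I_m.$$
   Context: For a matroid $M$ on ground set $\mathcal{A}$ with rank function $\mathrm{rk}$, $T^2_M(x_1,x_2;y_1,y_2)=\sum_{S_1\subseteq S_2\subseteq\mathcal{A}}\prod_{i=1}^2(x_i-1)^{\mathrm{rk}(\mathcal{A})-\mathrm{rk}(S_i)}(y_i-1)^{|S_i|-\mathrm{rk}(S_i)}$, regarded as a polynomial; $\mathrm{rk}(M)=\mathrm{rk}(\mathcal{A})$. -}

module Defs where

open import Data.Nat as ℕ using (ℕ; zero; suc; _≤_)
open import Data.Nat.Properties as ℕP using ()
open import Data.Integer as ℤ using (ℤ; +_)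
open import Data.Bool using (true; false)
open import Data.Vec using ([]; _∷_)
open import Data.List using (List; []; _∷_; map; _++_; filter; length; sum; upTo; concatMap)
open import Data.Fin.Subset using (Subset; _⊆_; _∪_; _∩_; ∣_∣; ⊤; inside; outside)
open import Data.Fin.Subset.Properties using (_⊆?_)
open import Relation.Binary.PropositionalEquality using (_≡_)
open import Relation.Nullary.Decidable using (Dec; _×-dec_)

record Matroid (n : ℕ) : Set where
  field
    rk          : Subset n → ℕ
    rk-≤-card   : ∀ S → rk S ≤ ∣ S ∣
    rk-mono     : ∀ {S T} → S ⊆ T → rk S ≤ rk T
    rk-submod   : ∀ S T → rk (S ∪ T) ℕ.+ rk (S ∩ T) ≤ rk S ℕ.+ rk T

open Matroid public

rank : ∀ {n} → Matroid n → ℕ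
rank M = rk M ⊤

allSubsets : (n : ℕ) → List (Subset n)
allSubsets zero = [] ∷ []
allSubsets (suc n) = map (outside ∷_) (allSubsets n) ++ map (inside ∷_) (allSubsets n)

-- integer power with 0^0 = 1 (polynomial evaluation convention)
_^ℤ_ : ℤ → ℕ → ℤ
x ^ℤ zero = + 1
x ^ℤ suc k = x ℤ.* (x ^ℤ k)

term : ∀ {n} → Matroid n → ℤ → ℤ → Subset n → ℤ
term M x y S =
  ((x ℤ.- + 1) ^ℤ (rank M ℕ.∸ rk M S)) ℤ.* ((y ℤ.- + 1) ^ℤ (∣ S ∣ ℕ.∸ rk M S))

T2 : ∀ {n} → Matroid n → ℤ → ℤ → ℤ → ℤ → ℤ
T2 {n} M x₁ x₂ y₁ y₂ =
  sumℤ (concatMap (λ S₂ → map (λ S₁ → term M x₁ y₁ S₁ ℤ.* term M x₂ y₂ S₂)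
                               (filter (λ S₁ → S₁ ⊆? S₂) (allSubsets n)))
                  (allSubsets n))
  where
  sumℤ : List ℤ → ℤ
  sumℤ [] = + 0
  sumℤ (z ∷ zs) = z ℤ.+ sumℤ zs

Independent : ∀ {n} → Matroid n → Subset n → Set
Independent M S = rk M S ≡ ∣ S ∣

numIndep : ∀ {n} → Matroid n → ℕ → ℕ
numIndep {n} M m =
  length (filter (λ S → (rk M S ℕ.≟ ∣ S ∣) ×-dec (∣ S ∣ ℕ.≟ m)) (allSubsets n))

sumTo : ℕ → (ℕ → ℕ) → ℕ
sumTo zero f = f zero
sumTo (suc N) f = sumTo N f ℕ.+ f (suc N)

{-# OPTIONS --safe #-}
-- At (x, y) = (2, 1) the summand of S is 1^(rk 𝒜 - rk S) · 0^(|S| - rk S), which is 1 when S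
-- is independent and 0 otherwise. So T²_M(2,2;1,1) counts the pairs S₁ ⊆ S₂ of independent
-- sets. Subsets of independent sets are independent (by subadditivity of rk), so an
-- independent S₂ contributes 2^|S₂|; grouping the independent sets by size m ≤ rk(M)
-- gives ∑ 2^m I_m.
module Submission where

open import Defs
open import Data.Nat using (ℕ; _^_; _*_)
open import Data.Integer using (+_)
open import Relation.Binary.PropositionalEquality using (_≡_)

open import Data.Bool using (true; false; if_then_else_)
open import Data.Fin.Subset using (Subset; _⊆_; _∪_; _─_; ∣_∣; inside; outside)
open import Data.Fin.Subset.Properties using (_⊆?_; drop-∷-⊆; ⊆⊤)
open import Data.Integer as ℤ using (ℤ)
open import Data.Integer.Properties as ℤ using (pos-+; pos-*)
open import Data.List using (List; []; _∷_; _++_; map; filter; length; foldr; concatMap)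
open import Data.List.Properties using (map-++; map-∘; map-cong; filter-all; foldr-universal)
open import Data.List.Relation.Unary.All as All using (All)
open import Data.List.Relation.Unary.All.Properties using (all-filter)
open import Data.Nat using (zero; suc; _+_; _∸_; _≤_; z≤n; s≤s; _≟_)
open import Data.Nat.ListAction using (sum)
open import Data.Nat.ListAction.Properties using (sum-++)
open import Data.Nat.Properties
open import Algebra.Properties.CommutativeSemigroup +-commutativeSemigroup using (interchange)
open import Data.Product using (_×_)
open import Data.Vec using ([]; _∷_; here)
open import Function using (_∘_)
open import Level using (0ℓ)
open import Relation.Binary.PropositionalEquality
  using (_≢_; refl; sym; trans; cong; cong₂; subst; module ≡-Reasoning)
open import Relation.Nullary using (Dec; yes; no; does; ¬_; contradiction)
open import Relation.Nullary.Decidable using (_×-dec_)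
open import Relation.Unary using (Pred; Decidable)

private
  variable
    A : Set
    n : ℕ

𝟙 : {P : Set} → Dec P → ℕ
𝟙 P? = if does P? then 1 else 0

𝟙-accept : {P : Set} (P? : Dec P) → P → 𝟙 P? ≡ 1
𝟙-accept (yes _) _  = refl
𝟙-accept (no ¬p) p = contradiction p ¬p

𝟙-reject : {P : Set} (P? : Dec P) → ¬ P → 𝟙 P? ≡ 0
𝟙-reject (yes p) ¬p = contradiction p ¬p
𝟙-reject (no _)  _  = refl

module _ {P : Pred A 0ℓ} (P? : Decidable P) where

  length-filter-∷ : ∀ x xs → length (filter P? (x ∷ xs)) ≡ 𝟙 (P? x) + length (filter P? xs)
  length-filter-∷ x xs with does (P? x)
  ... | true  = refl
  ... | false = refl

  sum-map-𝟙 : ∀ xs → sum (map (𝟙 ∘ P?) xs) ≡ length (filter P? xs)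
  sum-map-𝟙 []       = refl
  sum-map-𝟙 (x ∷ xs) = trans (cong (_+_ (𝟙 (P? x))) (sum-map-𝟙 xs)) (sym (length-filter-∷ x xs))

sum-map-zero : (xs : List A) → sum (map (λ _ → 0) xs) ≡ 0
sum-map-zero []       = refl
sum-map-zero (_ ∷ xs) = sum-map-zero xs

sum-map-*ʳ : (f : A → ℕ) (c : ℕ) (xs : List A) → sum (map (λ x → f x * c) xs) ≡ sum (map f xs) * c
sum-map-*ʳ f c []       = refl
sum-map-*ʳ f c (x ∷ xs) =
  trans (cong (_+_ (f x * c)) (sum-map-*ʳ f c xs)) (sym (*-distribʳ-+ c (f x) (sum (map f xs))))

sumTo-cong : ∀ r {f g : ℕ → ℕ} → (∀ m → f m ≡ g m) → sumTo r f ≡ sumTo r g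
sumTo-cong zero    f≡g = f≡g 0
sumTo-cong (suc r) f≡g = cong₂ _+_ (sumTo-cong r f≡g) (f≡g (suc r))

sumTo-+ : ∀ r (f g : ℕ → ℕ) → sumTo r (λ m → f m + g m) ≡ sumTo r f + sumTo r g
sumTo-+ zero    f g = refl
sumTo-+ (suc r) f g =
  trans (cong₂ _+_ (sumTo-+ r f g) refl)
        (interchange (sumTo r f) (sumTo r g) (f (suc r)) (g (suc r)))

sumTo-zero : ∀ r {f : ℕ → ℕ} → (∀ m → m ≤ r → f m ≡ 0) → sumTo r f ≡ 0
sumTo-zero zero    f≡0 = f≡0 0 z≤n
sumTo-zero (suc r) f≡0 =
  cong₂ _+_ (sumTo-zero r (λ m m≤r → f≡0 m (m≤n⇒m≤1+n m≤r))) (f≡0 (suc r) ≤-refl)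

sumTo-sift : ∀ r (f : ℕ → ℕ) {k} → k ≤ r → sumTo r (λ m → f m * 𝟙 (k ≟ m)) ≡ f k
sumTo-sift zero    f z≤n = *-identityʳ (f 0)
sumTo-sift (suc r) f {k} k≤1+r with k ≟ suc r
... | yes refl = begin
  sumTo r (λ m → f m * 𝟙 (suc r ≟ m)) + f (suc r) * 𝟙 (suc r ≟ suc r)
    ≡⟨ cong₂ _+_ (sumTo-zero r earlier) (cong (f (suc r) *_) (𝟙-accept (suc r ≟ suc r) refl)) ⟩
  f (suc r) * 1
    ≡⟨ *-identityʳ (f (suc r)) ⟩
  f (suc r) ∎
  where
  open ≡-Reasoning
  earlier : ∀ m → m ≤ r → f m * 𝟙 (suc r ≟ m) ≡ 0
  earlier m m≤r = trans (cong (f m *_) (𝟙-reject (suc r ≟ m) (>⇒≢ (s≤s m≤r)))) (*-zeroʳ (f m))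
... | no k≢1+r = begin
  sumTo r (λ m → f m * 𝟙 (k ≟ m)) + f (suc r) * 𝟙 (k ≟ suc r)
    ≡⟨ cong₂ _+_ (sumTo-sift r f (≤-pred (≤∧≢⇒< k≤1+r k≢1+r)))
                 (cong (f (suc r) *_) (𝟙-reject (k ≟ suc r) k≢1+r)) ⟩
  f k + f (suc r) * 0
    ≡⟨ cong (_+_ (f k)) (*-zeroʳ (f (suc r))) ⟩
  f k + 0
    ≡⟨ +-identityʳ (f k) ⟩
  f k ∎
  where open ≡-Reasoning

module _ {P : Pred A 0ℓ} (P? : Decidable P) (size : A → ℕ) (f : ℕ → ℕ) {r : ℕ}
         (bounded : ∀ x → P x → size x ≤ r) where

  sumTo-fibre-𝟙 : ∀ x → sumTo r (λ m → f m * 𝟙 (P? x ×-dec (size x ≟ m))) ≡ 𝟙 (P? x) * f (size x)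
  sumTo-fibre-𝟙 x with P? x
  ... | yes px = trans (sumTo-sift r f (bounded x px)) (sym (*-identityˡ (f (size x))))
  ... | no _   = sumTo-zero r (λ m _ → *-zeroʳ (f m))

  sum-partition-by-size : ∀ xs →
    sum (map (λ x → 𝟙 (P? x) * f (size x)) xs) ≡
    sumTo r (λ m → f m * length (filter (λ x → P? x ×-dec (size x ≟ m)) xs))
  sum-partition-by-size []       = sym (sumTo-zero r (λ m _ → *-zeroʳ (f m)))
  sum-partition-by-size (x ∷ xs) = begin
    𝟙 (P? x) * f (size x) + sum (map (λ x → 𝟙 (P? x) * f (size x)) xs)
      ≡⟨ cong₂ _+_ (sym (sumTo-fibre-𝟙 x)) (sum-partition-by-size xs) ⟩
    sumTo r (λ m → f m * 𝟙 (Q? m x)) + sumTo r (λ m → f m * length (filter (Q? m) xs))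
      ≡⟨ sym (sumTo-+ r _ _) ⟩
    sumTo r (λ m → f m * 𝟙 (Q? m x) + f m * length (filter (Q? m) xs))
      ≡⟨ sumTo-cong r (λ m → trans (sym (*-distribˡ-+ (f m) _ _))
                                   (cong (f m *_) (sym (length-filter-∷ (Q? m) x xs)))) ⟩
    sumTo r (λ m → f m * length (filter (Q? m) (x ∷ xs))) ∎
    where
    open ≡-Reasoning
    Q? : ∀ m → Decidable (λ x → P x × size x ≡ m)
    Q? m x = P? x ×-dec (size x ≟ m)

subsetsOf : Subset n → List (Subset n)
subsetsOf {n} T = filter (_⊆? T) (allSubsets n)

sum-allSubsets-suc : (f : Subset (suc n) → ℕ) →
  sum (map f (allSubsets (suc n))) ≡
  sum (map (f ∘ (outside ∷_)) (allSubsets n)) + sum (map (f ∘ (inside ∷_)) (allSubsets n))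
sum-allSubsets-suc {n} f = begin
  sum (map f (map (outside ∷_) Ss ++ map (inside ∷_) Ss))
    ≡⟨ cong sum (map-++ f (map (outside ∷_) Ss) _) ⟩
  sum (map f (map (outside ∷_) Ss) ++ map f (map (inside ∷_) Ss))
    ≡⟨ sum-++ (map f (map (outside ∷_) Ss)) _ ⟩
  sum (map f (map (outside ∷_) Ss)) + sum (map f (map (inside ∷_) Ss))
    ≡⟨ cong₂ _+_ (cong sum (sym (map-∘ Ss))) (cong sum (sym (map-∘ Ss))) ⟩
  sum (map (f ∘ (outside ∷_)) Ss) + sum (map (f ∘ (inside ∷_)) Ss) ∎
  where
  open ≡-Reasoning
  Ss = allSubsets n

sum-𝟙-⊆ : (T : Subset n) → sum (map (λ S → 𝟙 (S ⊆? T)) (allSubsets n)) ≡ 2 ^ ∣ T ∣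
sum-𝟙-⊆ []                     = refl
sum-𝟙-⊆ {suc n} (outside ∷ T) = begin
  sum (map (λ S → 𝟙 (S ⊆? outside ∷ T)) (allSubsets (suc n)))
    ≡⟨ sum-allSubsets-suc (λ S → 𝟙 (S ⊆? outside ∷ T)) ⟩
  sum (map (λ S → 𝟙 (S ⊆? T)) (allSubsets n)) + sum (map (λ _ → 0) (allSubsets n))
    ≡⟨ cong₂ _+_ (sum-𝟙-⊆ T) (sum-map-zero (allSubsets n)) ⟩
  2 ^ ∣ T ∣ + 0
    ≡⟨ +-identityʳ (2 ^ ∣ T ∣) ⟩
  2 ^ ∣ T ∣ ∎
  where open ≡-Reasoning
sum-𝟙-⊆ {suc n} (inside ∷ T)  = begin
  sum (map (λ S → 𝟙 (S ⊆? inside ∷ T)) (allSubsets (suc n)))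
    ≡⟨ sum-allSubsets-suc (λ S → 𝟙 (S ⊆? inside ∷ T)) ⟩
  sum (map (λ S → 𝟙 (S ⊆? T)) (allSubsets n)) + sum (map (λ S → 𝟙 (S ⊆? T)) (allSubsets n))
    ≡⟨ cong₂ _+_ (sum-𝟙-⊆ T) (trans (sum-𝟙-⊆ T) (sym (+-identityʳ (2 ^ ∣ T ∣)))) ⟩
  2 * 2 ^ ∣ T ∣ ∎
  where open ≡-Reasoning

length-subsetsOf : (T : Subset n) → length (subsetsOf T) ≡ 2 ^ ∣ T ∣
length-subsetsOf {n} T = trans (sym (sum-map-𝟙 (_⊆? T) (allSubsets n))) (sum-𝟙-⊆ T)

p⊆q⇒p∪[q─p]≡q : {p q : Subset n} → p ⊆ q → p ∪ (q ─ p) ≡ q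
p⊆q⇒p∪[q─p]≡q {p = []}          {[]}          _   = refl
p⊆q⇒p∪[q─p]≡q {p = outside ∷ p} {outside ∷ q} p⊆q = cong (outside ∷_) (p⊆q⇒p∪[q─p]≡q (drop-∷-⊆ p⊆q))
p⊆q⇒p∪[q─p]≡q {p = outside ∷ p} {inside  ∷ q} p⊆q = cong (inside ∷_) (p⊆q⇒p∪[q─p]≡q (drop-∷-⊆ p⊆q))
p⊆q⇒p∪[q─p]≡q {p = inside  ∷ p} {outside ∷ q} p⊆q = contradiction (p⊆q here) λ ()
p⊆q⇒p∪[q─p]≡q {p = inside  ∷ p} {inside  ∷ q} p⊆q = cong (inside ∷_) (p⊆q⇒p∪[q─p]≡q (drop-∷-⊆ p⊆q))

p⊆q⇒∣q∣≡∣p∣+∣q─p∣ : {p q : Subset n} → p ⊆ q → ∣ q ∣ ≡ ∣ p ∣ + ∣ q ─ p ∣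
p⊆q⇒∣q∣≡∣p∣+∣q─p∣ {p = []}          {[]}          _   = refl
p⊆q⇒∣q∣≡∣p∣+∣q─p∣ {p = outside ∷ p} {outside ∷ q} p⊆q = p⊆q⇒∣q∣≡∣p∣+∣q─p∣ (drop-∷-⊆ p⊆q)
p⊆q⇒∣q∣≡∣p∣+∣q─p∣ {p = outside ∷ p} {inside  ∷ q} p⊆q =
  trans (cong suc (p⊆q⇒∣q∣≡∣p∣+∣q─p∣ (drop-∷-⊆ p⊆q))) (sym (+-suc ∣ p ∣ ∣ q ─ p ∣))
p⊆q⇒∣q∣≡∣p∣+∣q─p∣ {p = inside  ∷ p} {outside ∷ q} p⊆q = contradiction (p⊆q here) λ ()
p⊆q⇒∣q∣≡∣p∣+∣q─p∣ {p = inside  ∷ p} {inside  ∷ q} p⊆q = cong suc (p⊆q⇒∣q∣≡∣p∣+∣q─p∣ (drop-∷-⊆ p⊆q))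

1^ℤk≡1 : ∀ k → (+ 1) ^ℤ k ≡ + 1
1^ℤk≡1 zero    = refl
1^ℤk≡1 (suc k) = trans (ℤ.*-identityˡ _) (1^ℤk≡1 k)

0^ℤk≡0 : ∀ {k} → k ≢ 0 → (+ 0) ^ℤ k ≡ + 0
0^ℤk≡0 {zero}  k≢0 = contradiction refl k≢0
0^ℤk≡0 {suc k} _   = refl

sumℤ : List ℤ → ℤ
sumℤ = foldr ℤ._+_ (+ 0)

sumℤ-++ : ∀ xs ys → sumℤ (xs ++ ys) ≡ sumℤ xs ℤ.+ sumℤ ys
sumℤ-++ []       ys = sym (ℤ.+-identityˡ (sumℤ ys))
sumℤ-++ (x ∷ xs) ys =
  trans (cong (ℤ._+_ x) (sumℤ-++ xs ys)) (sym (ℤ.+-assoc x (sumℤ xs) (sumℤ ys)))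

sumℤ-map-pos : {F : A → ℤ} {G : A → ℕ} → (∀ x → F x ≡ + G x) →
  ∀ xs → sumℤ (map F xs) ≡ + sum (map G xs)
sumℤ-map-pos F≡G []       = refl
sumℤ-map-pos {G = G} F≡G (x ∷ xs) =
  trans (cong₂ ℤ._+_ (F≡G x) (sumℤ-map-pos F≡G xs)) (sym (pos-+ (G x) (sum (map G xs))))

sumℤ-concatMap-pos : {B : Set} {F : B → A → ℤ} {G : B → A → ℕ} (as : B → List A) →
  (∀ b x → F b x ≡ + G b x) →
  ∀ bs → sumℤ (concatMap (λ b → map (F b) (as b)) bs) ≡
         + sum (map (λ b → sum (map (G b) (as b))) bs)
sumℤ-concatMap-pos as F≡G []       = refl
sumℤ-concatMap-pos {B = B} {F} {G} as F≡G (b ∷ bs) = begin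
  sumℤ (map (F b) (as b) ++ concatMap (λ b → map (F b) (as b)) bs)
    ≡⟨ sumℤ-++ (map (F b) (as b)) _ ⟩
  sumℤ (map (F b) (as b)) ℤ.+ sumℤ (concatMap (λ b → map (F b) (as b)) bs)
    ≡⟨ cong₂ ℤ._+_ (sumℤ-map-pos (F≡G b) (as b)) (sumℤ-concatMap-pos as F≡G bs) ⟩
  + inner b ℤ.+ + sum (map inner bs)
    ≡⟨ pos-+ (inner b) (sum (map inner bs)) ⟨
  + sum (map inner (b ∷ bs)) ∎
  where
  open ≡-Reasoning
  inner : B → ℕ
  inner b = sum (map (G b) (as b))

-- T2 sums with a where-bound function that cannot be referred to; abstracting the summed list
-- lets unification identify that function with foldr via foldr-universal.
T2≡sumℤ : (M : Matroid n) (x₁ x₂ y₁ y₂ : ℤ) →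
  T2 M x₁ x₂ y₁ y₂ ≡
  sumℤ (concatMap (λ S₂ → map (λ S₁ → term M x₁ y₁ S₁ ℤ.* term M x₂ y₂ S₂) (subsetsOf S₂))
                  (allSubsets n))
T2≡sumℤ {n} M x₁ x₂ y₁ y₂
  with concatMap (λ S₂ → map (λ S₁ → term M x₁ y₁ S₁ ℤ.* term M x₂ y₂ S₂) (subsetsOf S₂))
                 (allSubsets n)
     | foldr-universal _ ℤ._+_ (+ 0) refl (λ _ _ → refl)
... | zs | local-sum≗sumℤ = local-sum≗sumℤ zs

module _ (M : Matroid n) where

  independent? : Decidable (Independent M)
  independent? S = rk M S ≟ ∣ S ∣

  nullity : Subset n → ℕ
  nullity S = ∣ S ∣ ∸ rk M S

  rk-subadditive : ∀ S T → rk M (S ∪ T) ≤ rk M S + rk M T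
  rk-subadditive S T = ≤-trans (m≤m+n (rk M (S ∪ T)) _) (rk-submod M S T)

  independent-⊆ : ∀ {S T} → S ⊆ T → Independent M T → Independent M S
  independent-⊆ {S} {T} S⊆T indT =
    ≤-antisym (rk-≤-card M S) (+-cancelʳ-≤ ∣ T ─ S ∣ ∣ S ∣ (rk M S) (begin
      ∣ S ∣ + ∣ T ─ S ∣       ≡⟨ p⊆q⇒∣q∣≡∣p∣+∣q─p∣ S⊆T ⟨
      ∣ T ∣                   ≡⟨ indT ⟨
      rk M T                  ≡⟨ cong (rk M) (p⊆q⇒p∪[q─p]≡q S⊆T) ⟨
      rk M (S ∪ (T ─ S))      ≤⟨ rk-subadditive S (T ─ S) ⟩
      rk M S + rk M (T ─ S)   ≤⟨ +-monoʳ-≤ (rk M S) (rk-≤-card M (T ─ S)) ⟩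
      rk M S + ∣ T ─ S ∣      ∎))
    where open ≤-Reasoning

  independent⇒∣∣≤rank : ∀ S → Independent M S → ∣ S ∣ ≤ rank M
  independent⇒∣∣≤rank S indS = subst (_≤ rank M) indS (rk-mono M ⊆⊤)

  sum-𝟙-independent-subsetsOf : ∀ T →
    sum (map (λ S → 𝟙 (independent? S) * 𝟙 (independent? T)) (subsetsOf T)) ≡
    𝟙 (independent? T) * 2 ^ ∣ T ∣
  sum-𝟙-independent-subsetsOf T = begin
    sum (map (λ S → 𝟙 (independent? S) * 𝟙 (independent? T)) (subsetsOf T))
      ≡⟨ sum-map-*ʳ (𝟙 ∘ independent?) _ (subsetsOf T) ⟩
    sum (map (𝟙 ∘ independent?) (subsetsOf T)) * 𝟙 (independent? T)
      ≡⟨ cong (_* 𝟙 (independent? T)) (sum-map-𝟙 independent? (subsetsOf T)) ⟩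
    length (filter independent? (subsetsOf T)) * 𝟙 (independent? T)
      ≡⟨ count (independent? T) ⟩
    𝟙 (independent? T) * 2 ^ ∣ T ∣ ∎
    where
    open ≡-Reasoning
    count : (indT? : Dec (Independent M T)) →
            length (filter independent? (subsetsOf T)) * 𝟙 indT? ≡ 𝟙 indT? * 2 ^ ∣ T ∣
    count (no _)     = *-zeroʳ (length (filter independent? (subsetsOf T)))
    count (yes indT) = begin
      length (filter independent? (subsetsOf T)) * 1
        ≡⟨ *-identityʳ _ ⟩
      length (filter independent? (subsetsOf T))
        ≡⟨ cong length (filter-all independent?
                          (All.map {P = _⊆ T} (λ S⊆T → independent-⊆ S⊆T indT)
                                   (all-filter (_⊆? T) (allSubsets n)))) ⟩
      length (subsetsOf T)
        ≡⟨ length-subsetsOf T ⟩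
      2 ^ ∣ T ∣
        ≡⟨ *-identityˡ (2 ^ ∣ T ∣) ⟨
      1 * 2 ^ ∣ T ∣ ∎

  zero^nullity : ∀ S → (+ 0) ^ℤ nullity S ≡ + 𝟙 (independent? S)
  zero^nullity S = from (independent? S)
    where
    from : (indS? : Dec (Independent M S)) → (+ 0) ^ℤ nullity S ≡ + 𝟙 indS?
    from (yes indS) = trans (cong (λ r → (+ 0) ^ℤ (∣ S ∣ ∸ r)) indS) (cong ((+ 0) ^ℤ_) (n∸n≡0 ∣ S ∣))
    from (no ¬indS) =
      0^ℤk≡0 (λ nullity≡0 → ¬indS (≤-antisym (rk-≤-card M S) (m∸n≡0⇒m≤n nullity≡0)))

  term-2-1 : ∀ S → term M (+ 2) (+ 1) S ≡ + 𝟙 (independent? S)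
  term-2-1 S = begin
    (+ 1) ^ℤ (rank M ∸ rk M S) ℤ.* (+ 0) ^ℤ nullity S
      ≡⟨ cong (ℤ._* ((+ 0) ^ℤ nullity S)) (1^ℤk≡1 (rank M ∸ rk M S)) ⟩
    + 1 ℤ.* (+ 0) ^ℤ nullity S
      ≡⟨ ℤ.*-identityˡ _ ⟩
    (+ 0) ^ℤ nullity S
      ≡⟨ zero^nullity S ⟩
    + 𝟙 (independent? S) ∎
    where open ≡-Reasoning

proposition5p4 : (n : ℕ) (M : Matroid n) →
    T2 M (+ 2) (+ 2) (+ 1) (+ 1) ≡ + sumTo (rank M) (λ m → (2 ^ m) * numIndep M m)
proposition5p4 n M = begin
  T2 M (+ 2) (+ 2) (+ 1) (+ 1)
    ≡⟨ T2≡sumℤ M (+ 2) (+ 2) (+ 1) (+ 1) ⟩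
  sumℤ (concatMap (λ T → map (λ S → term M (+ 2) (+ 1) S ℤ.* term M (+ 2) (+ 1) T) (subsetsOf T))
                  (allSubsets n))
    ≡⟨ sumℤ-concatMap-pos subsetsOf term-product (allSubsets n) ⟩
  + sum (map (λ T → sum (map (λ S → ι S * ι T) (subsetsOf T))) (allSubsets n))
    ≡⟨ cong (+_ ∘ sum) (map-cong (sum-𝟙-independent-subsetsOf M) (allSubsets n)) ⟩
  + sum (map (λ T → ι T * 2 ^ ∣ T ∣) (allSubsets n))
    ≡⟨ cong +_ (sum-partition-by-size (independent? M) ∣_∣ (2 ^_) (independent⇒∣∣≤rank M)
                                      (allSubsets n)) ⟩
  + sumTo (rank M) (λ m → 2 ^ m * numIndep M m) ∎
  where
  open ≡-Reasoning
  ι : Subset n → ℕ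
  ι S = 𝟙 (independent? M S)
  term-product : ∀ T S → term M (+ 2) (+ 1) S ℤ.* term M (+ 2) (+ 1) T ≡ + (ι S * ι T)
  term-product T S = trans (cong₂ ℤ._*_ (term-2-1 M S) (term-2-1 M T)) (sym (pos-* (ι S) (ι T)))
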